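{- For integers $1\le m\le n$, $$|\mathrm{PF}(m,n)|=\sum_{k=n-m+1}^n k\binom{m-1}{n-k}|\mathrm{PF}(m-n+k-1,k-1)|\,|\mathrm{PF}(n-k,n-k)|.$$
   Context: For $0\le a\le b$, $\mathrm{PF}(a,b)$ is the set of sequences $\pi\in\{1,\dots,b\}^a$ such that, when spots $1,\dots,b$ are initially empty and for $i=1,\dots,a$ in turn car $i$ parks in the first empty spot among $\pi_i,\pi_i+1,\dots,b$, every car parks; $\mathrm{PF}(0,b)$ consists of the empty sequence only, so $|\mathrm{PF}(0,b)|=1$. -}

module Defs where

open import Data.Nat using (ℕ; zero; suc; _+_; _*_; _∸_; _≤_)
open import Data.Fin using (Fin; toℕ) renaming (zero to fzero; suc to fsuc)
open import Data.Bool using (Bool; true; false; _≟_)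
open import Data.Maybe using (Maybe; just; nothing)
open import Data.Vec using (Vec; []; _∷_)
open import Data.List using (List; []; _∷_; length; filter; map; concatMap; upTo)
open import Data.Product using (_×_; _,_)
open import Relation.Nullary using (Dec; yes; no)
open import Relation.Binary.PropositionalEquality using (_≡_; refl)

-- Spots 1..b are represented by a Vec Bool b (true = occupied);
-- the spot with 0-based index j is spot j+1.  A preference is an
-- element of Fin b (0-based index i stands for spot i+1).

parkFrom : {b : ℕ} → ℕ → Vec Bool b → Maybe (Vec Bool b)
parkFrom p [] = nothing
parkFrom zero (false ∷ s) = just (true ∷ s)
parkFrom zero (true ∷ s) with parkFrom zero s
... | just s' = just (true ∷ s')
... | nothing = nothing
parkFrom (suc p) (x ∷ s) with parkFrom p s
... | just s' = just (x ∷ s')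
... | nothing = nothing

emptySpots : (b : ℕ) → Vec Bool b
emptySpots zero = []
emptySpots (suc b) = false ∷ emptySpots b

runCars : {a b : ℕ} → Vec (Fin b) a → Vec Bool b → Maybe (Vec Bool b)
runCars [] s = just s
runCars (p ∷ π) s with parkFrom (toℕ p) s
... | just s' = runCars π s'
... | nothing = nothing

isParking : {a b : ℕ} → Vec (Fin b) a → Bool
isParking π with runCars π (emptySpots _)
... | just _ = true
... | nothing = false

allFinL : (b : ℕ) → List (Fin b)
allFinL zero = []
allFinL (suc b) = fzero ∷ map fsuc (allFinL b)

allSeqs : (a b : ℕ) → List (Vec (Fin b) a)
allSeqs zero b = [] ∷ []
allSeqs (suc a) b = concatMap (λ p → map (p ∷_) (allSeqs a b)) (allFinL b)

countPF : ℕ → ℕ → ℕ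
countPF a b = length (filter (λ π → isParking π ≟ true) (allSeqs a b))

sumFromTo : ℕ → ℕ → (ℕ → ℕ) → ℕ
sumFromTo lo hi f = go (suc hi ∸ lo)
  where
  go : ℕ → ℕ
  go zero = 0
  go (suc i) = f (lo + i) + go i

-- A list of 0-based preferences in [0, b) parks iff, for every s ≤ b, at most b − s of its
-- entries are ≥ s.  Remove the first car: the other m − 1 cars form a parking sequence l, and a
-- first car with preference p parks iff every threshold s ≤ p is slack for l, i.e. fewer than
-- n − s entries of l are ≥ s.  Threshold n is never slack, so if k is the first tight threshold
-- of l there are exactly k good values of p.  Cutting l at k, the entries below k form a parking
-- sequence for k − 1 spots and the entries ≥ k, shifted down by k, one of length n − k for n − k
-- spots; choosing which of the m − 1 cars lie above the cut gives the binomial coefficient.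

module Submission where

open import Defs
open import Algebra.Properties.CommutativeSemigroup as CSProperties using ()
open import Data.Bool using (Bool; true; false; if_then_else_) renaming (_≟_ to _≟ᵇ_)
open import Data.Fin using (Fin; toℕ)
open import Data.Fin.Properties using (toℕ<n)
open import Data.List using (List; []; _∷_; _++_; length; filter; map; concatMap)
open import Data.List.Membership.Propositional using (_∈_)
open import Data.List.Properties using (map-++; map-cong; map-∘)
open import Data.List.Relation.Unary.Any using (here; there)
open import Data.Maybe using (just; nothing)
open import Data.Nat using (ℕ; zero; suc; _+_; _*_; _∸_; _≤_; _<_; _≤?_; _<?_; _≟_; z≤n; s≤s)
open import Data.Nat.Combinatorics using (_C_; nCk+nC[k+1]≡[n+1]C[k+1]; k>n⇒nCk≡0)
open import Data.Nat.ListAction using (sum)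
open import Data.Nat.ListAction.Properties using (sum-++)
open import Data.Nat.Properties
open import Data.Product using (_×_; _,_; proj₂; ∃-syntax)
open import Data.Sum using (inj₁; inj₂)
open import Data.Vec using (Vec; []; _∷_)
import Data.Vec as Vec
open import Function using (_⇔_; mk⇔; Equivalence; _∘′_)
open import Relation.Binary.PropositionalEquality
open import Relation.Nullary using (Dec; yes; no; does; ¬_; ¬?; _×-dec_; contradiction)
open import Relation.Nullary.Decidable using (does-⇔; dec-true; dec-false)
open import Relation.Unary using (Pred; Decidable)
open CSProperties +-commutativeSemigroup using ()
  renaming (interchange to +-interchange; x∙yz≈y∙xz to +-left-comm; xy∙z≈xz∙y to +-right-comm)
open CSProperties *-commutativeSemigroup using () renaming (x∙yz≈y∙xz to *-left-comm)
open ≡-Reasoning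

-- Finite sums

𝟙 : ∀ {p} {P : Set p} → Dec P → ℕ
𝟙 P? = if does P? then 1 else 0

module _ {p q} {P : Set p} {Q : Set q} where

  𝟙-⇔ : P ⇔ Q → (P? : Dec P) (Q? : Dec Q) → 𝟙 P? ≡ 𝟙 Q?
  𝟙-⇔ P⇔Q P? Q? = cong (if_then 1 else 0) (does-⇔ P⇔Q P? Q?)

  𝟙-× : (P? : Dec P) (Q? : Dec Q) → 𝟙 (P? ×-dec Q?) ≡ 𝟙 P? * 𝟙 Q?
  𝟙-× (yes _) (yes _) = refl
  𝟙-× (yes _) (no _)  = refl
  𝟙-× (no _)  _       = refl

∑ : ℕ → (ℕ → ℕ) → ℕ
∑ zero    f = 0
∑ (suc n) f = f 0 + ∑ n (λ i → f (suc i))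

∑-cong : ∀ n {f g : ℕ → ℕ} → (∀ {i} → i < n → f i ≡ g i) → ∑ n f ≡ ∑ n g
∑-cong zero    f≗g = refl
∑-cong (suc n) f≗g = cong₂ _+_ (f≗g (s≤s z≤n)) (∑-cong n (λ i<n → f≗g (s≤s i<n)))

∑-zero : ∀ n {f : ℕ → ℕ} → (∀ {i} → i < n → f i ≡ 0) → ∑ n f ≡ 0
∑-zero zero    f≗0 = refl
∑-zero (suc n) f≗0 = cong₂ _+_ (f≗0 (s≤s z≤n)) (∑-zero n (λ i<n → f≗0 (s≤s i<n)))

∑-+ : ∀ n (f g : ℕ → ℕ) → ∑ n (λ i → f i + g i) ≡ ∑ n f + ∑ n g
∑-+ zero    f g = refl
∑-+ (suc n) f g = trans (cong (f 0 + g 0 +_) (∑-+ n (f ∘′ suc) (g ∘′ suc)))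
                        (+-interchange (f 0) (g 0) _ _)

∑-*ˡ : ∀ n c (f : ℕ → ℕ) → ∑ n (λ i → c * f i) ≡ c * ∑ n f
∑-*ˡ zero    c f = sym (*-zeroʳ c)
∑-*ˡ (suc n) c f = trans (cong (c * f 0 +_) (∑-*ˡ n c (f ∘′ suc)))
                         (sym (*-distribˡ-+ c (f 0) _))

∑-swap : ∀ n m (f : ℕ → ℕ → ℕ) →
         ∑ n (λ i → ∑ m (λ j → f i j)) ≡ ∑ m (λ j → ∑ n (λ i → f i j))
∑-swap zero    m f = sym (∑-zero m (λ _ → refl))
∑-swap (suc n) m f = trans (cong (∑ m (f 0) +_) (∑-swap n m (f ∘′ suc)))
                           (sym (∑-+ m (f 0) (λ j → ∑ n (λ i → f (suc i) j))))

∑-swap-*ˡ : ∀ n m (g : ℕ → ℕ) (f : ℕ → ℕ → ℕ) →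
            ∑ n (λ i → ∑ m (λ j → g j * f i j)) ≡ ∑ m (λ j → g j * ∑ n (λ i → f i j))
∑-swap-*ˡ n m g f = trans (∑-swap n m (λ i j → g j * f i j))
                          (∑-cong m (λ {j} _ → ∑-*ˡ n (g j) (λ i → f i j)))

∑-last : ∀ n (f : ℕ → ℕ) → ∑ (suc n) f ≡ ∑ n f + f n
∑-last zero    f = +-comm (f 0) 0
∑-last (suc n) f = trans (cong (f 0 +_) (∑-last n (f ∘′ suc))) (sym (+-assoc (f 0) _ _))

∑-split : ∀ a b (f : ℕ → ℕ) → ∑ (a + b) f ≡ ∑ a f + ∑ b (λ i → f (a + i))
∑-split zero    b f = refl
∑-split (suc a) b f = trans (cong (f 0 +_) (∑-split a b (f ∘′ suc))) (sym (+-assoc (f 0) _ _))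

∑-select : ∀ n r (g : ℕ → ℕ) → (∀ {c} → n ≤ c → g c ≡ 0) →
           ∑ n (λ c → 𝟙 (c ≟ r) * g c) ≡ g r
∑-select zero    r       g g≡0 = sym (g≡0 z≤n)
∑-select (suc n) zero    g g≡0 =
  trans (cong (g 0 + 0 +_) (∑-zero n (λ _ → refl))) (trans (+-identityʳ _) (+-identityʳ (g 0)))
∑-select (suc n) (suc r) g g≡0 = ∑-select n r (g ∘′ suc) (λ n≤c → g≡0 (s≤s n≤c))

∑-pascal : ∀ a (g : ℕ → ℕ → ℕ) →
  ∑ (suc a) (λ c → (a C c) * g (suc (a ∸ c)) c) + ∑ (suc a) (λ c → (a C c) * g (a ∸ c) (suc c))
  ≡ ∑ (suc (suc a)) (λ c → (suc a C c) * g (suc a ∸ c) c)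
∑-pascal a g = begin
  (g₀ + ∑ a (λ c → (a C suc c) * g (suc (a ∸ suc c)) (suc c))) + ∑ (suc a) L
    ≡⟨ cong (λ s → (g₀ + s) + ∑ (suc a) L) (∑-cong a shift) ⟩
  (g₀ + ∑ a R) + ∑ (suc a) L
    ≡⟨ cong (λ s → (g₀ + s) + ∑ (suc a) L) (sym R-last) ⟩
  (g₀ + ∑ (suc a) R) + ∑ (suc a) L
    ≡⟨ +-assoc g₀ _ _ ⟩
  g₀ + (∑ (suc a) R + ∑ (suc a) L)
    ≡⟨ cong (g₀ +_) (trans (+-comm (∑ (suc a) R) _) (sym (∑-+ (suc a) L R))) ⟩
  g₀ + ∑ (suc a) (λ c → L c + R c)
    ≡⟨ cong (g₀ +_) (∑-cong (suc a) (λ {c} _ → pascal c)) ⟩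
  g₀ + ∑ (suc a) (λ c → (suc a C suc c) * g (a ∸ c) (suc c))
    ∎
  where
  g₀ : ℕ
  g₀ = (a C 0) * g (suc a) 0
  L R : ℕ → ℕ
  L c = (a C c) * g (a ∸ c) (suc c)
  R c = (a C suc c) * g (a ∸ c) (suc c)
  shift : ∀ {c} → c < a → (a C suc c) * g (suc (a ∸ suc c)) (suc c) ≡ R c
  shift {c} c<a = cong (λ i → (a C suc c) * g i (suc c)) (sym (+-∸-assoc 1 c<a))
  R-last : ∑ (suc a) R ≡ ∑ a R
  R-last = trans (∑-last a R)
                 (trans (cong (λ z → ∑ a R + z * g (a ∸ a) (suc a)) (k>n⇒nCk≡0 {a} {suc a} (n<1+n a)))
                        (+-identityʳ _))
  pascal : ∀ c → L c + R c ≡ (suc a C suc c) * g (a ∸ c) (suc c)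
  pascal c = trans (sym (*-distribʳ-+ _ (a C c) (a C suc c)))
                   (cong (_* g (a ∸ c) (suc c)) (nCk+nC[k+1]≡[n+1]C[k+1] a c))

-- Sums over sequences

∑Seq : ℕ → ℕ → (List ℕ → ℕ) → ℕ
∑Seq zero    b w = w []
∑Seq (suc a) b w = ∑ b (λ p → ∑Seq a b (λ l → w (p ∷ l)))

∑Seq-cong : ∀ a b {v w : List ℕ → ℕ} → (∀ l → v l ≡ w l) → ∑Seq a b v ≡ ∑Seq a b w
∑Seq-cong zero    b v≗w = v≗w []
∑Seq-cong (suc a) b v≗w = ∑-cong b (λ {p} _ → ∑Seq-cong a b (λ l → v≗w (p ∷ l)))

∑Seq-zero : ∀ a b {w : List ℕ → ℕ} → (∀ l → w l ≡ 0) → ∑Seq a b w ≡ 0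
∑Seq-zero zero    b w≗0 = w≗0 []
∑Seq-zero (suc a) b w≗0 = ∑-zero b (λ {p} _ → ∑Seq-zero a b (λ l → w≗0 (p ∷ l)))

∑Seq-∑ : ∀ a b n (f : ℕ → List ℕ → ℕ) →
         ∑Seq a b (λ l → ∑ n (λ i → f i l)) ≡ ∑ n (λ i → ∑Seq a b (f i))
∑Seq-∑ zero    b n f = refl
∑Seq-∑ (suc a) b n f = trans (∑-cong b (λ {p} _ → ∑Seq-∑ a b n (λ i l → f i (p ∷ l))))
                             (∑-swap b n (λ p i → ∑Seq a b (λ l → f i (p ∷ l))))

∑Seq-*ˡ : ∀ a b c (w : List ℕ → ℕ) → ∑Seq a b (λ l → c * w l) ≡ c * ∑Seq a b w
∑Seq-*ˡ zero    b c w = refl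
∑Seq-*ˡ (suc a) b c w = trans (∑-cong b (λ {p} _ → ∑Seq-*ˡ a b c (λ l → w (p ∷ l))))
                              (∑-*ˡ b c (λ p → ∑Seq a b (λ l → w (p ∷ l))))

∑Seq-*ʳ : ∀ a b c (w : List ℕ → ℕ) → ∑Seq a b (λ l → w l * c) ≡ ∑Seq a b w * c
∑Seq-*ʳ a b c w = trans (∑Seq-cong a b (λ l → *-comm (w l) c))
                        (trans (∑Seq-*ˡ a b c w) (*-comm c _))

∑Seq-length : ∀ a b (f : ℕ → List ℕ → ℕ) → ∑Seq a b (λ l → f (length l) l) ≡ ∑Seq a b (f a)
∑Seq-length zero    b f = refl
∑Seq-length (suc a) b f = ∑-cong b (λ {p} _ → ∑Seq-length a b (λ n l → f (suc n) (p ∷ l)))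

∑Seq-restrict : ∀ a b (w : List ℕ → ℕ) → (∀ l → b ∈ l → w l ≡ 0) →
                ∑Seq a (suc b) w ≡ ∑Seq a b w
∑Seq-restrict zero    b w w≡0 = refl
∑Seq-restrict (suc a) b w w≡0 = begin
  ∑ (suc b) (λ p → ∑Seq a (suc b) (λ l → w (p ∷ l)))
    ≡⟨ ∑-last b _ ⟩
  ∑ b (λ p → ∑Seq a (suc b) (λ l → w (p ∷ l))) + ∑Seq a (suc b) (λ l → w (b ∷ l))
    ≡⟨ cong (∑ b (λ p → ∑Seq a (suc b) (λ l → w (p ∷ l))) +_)
            (∑Seq-zero a (suc b) (λ l → w≡0 (b ∷ l) (here refl))) ⟩
  ∑ b (λ p → ∑Seq a (suc b) (λ l → w (p ∷ l))) + 0
    ≡⟨ +-identityʳ _ ⟩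
  ∑ b (λ p → ∑Seq a (suc b) (λ l → w (p ∷ l)))
    ≡⟨ ∑-cong b (λ {p} _ → ∑Seq-restrict a b (λ l → w (p ∷ l))
                                         (λ l b∈l → w≡0 (p ∷ l) (there b∈l))) ⟩
  ∑ b (λ p → ∑Seq a b (λ l → w (p ∷ l)))
    ∎

below : ℕ → List ℕ → List ℕ
below k []      = []
below k (x ∷ l) = if does (k ≤? x) then below k l else x ∷ below k l

above : ℕ → List ℕ → List ℕ
above k []      = []
above k (x ∷ l) = if does (k ≤? x) then (x ∸ k) ∷ above k l else above k l

module _ {k x : ℕ} (l : List ℕ) where

  below-< : x < k → below k (x ∷ l) ≡ x ∷ below k l
  below-< x<k rewrite dec-false (k ≤? x) (<⇒≱ x<k) = refl

  above-< : x < k → above k (x ∷ l) ≡ above k l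
  above-< x<k rewrite dec-false (k ≤? x) (<⇒≱ x<k) = refl

  below-≥ : k ≤ x → below k (x ∷ l) ≡ below k l
  below-≥ k≤x rewrite dec-true (k ≤? x) k≤x = refl

  above-≥ : k ≤ x → above k (x ∷ l) ≡ (x ∸ k) ∷ above k l
  above-≥ k≤x rewrite dec-true (k ≤? x) k≤x = refl

∑Seq-split : ∀ a b₁ b₂ (W : List ℕ → List ℕ → ℕ) →
  ∑Seq a (b₁ + b₂) (λ l → W (below b₁ l) (above b₁ l)) ≡
  ∑ (suc a) (λ c → (a C c) * ∑Seq (a ∸ c) b₁ (λ x → ∑Seq c b₂ (W x)))
∑Seq-split zero    b₁ b₂ W = sym (trans (+-identityʳ _) (+-identityʳ _))
∑Seq-split (suc a) b₁ b₂ W = begin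
  ∑ (b₁ + b₂) (λ p → ∑Seq a (b₁ + b₂) (λ l → W (below b₁ (p ∷ l)) (above b₁ (p ∷ l))))
    ≡⟨ ∑-split b₁ b₂ _ ⟩
  ∑ b₁ (λ p → ∑Seq a (b₁ + b₂) (λ l → W (below b₁ (p ∷ l)) (above b₁ (p ∷ l))))
    + ∑ b₂ (λ q → ∑Seq a (b₁ + b₂) (λ l → W (below b₁ (b₁ + q ∷ l)) (above b₁ (b₁ + q ∷ l))))
    ≡⟨ cong₂ _+_ (∑-cong b₁ low) (∑-cong b₂ (λ {q} _ → high q)) ⟩
  ∑ b₁ (λ p → ∑ (suc a) (λ c → (a C c) * G (λ x → W (p ∷ x)) (a ∸ c) c))
    + ∑ b₂ (λ q → ∑ (suc a) (λ c → (a C c) * G (λ x y → W x (q ∷ y)) (a ∸ c) c))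
    ≡⟨ cong₂ _+_ (∑-swap-*ˡ b₁ (suc a) (a C_) (λ p c → G (λ x → W (p ∷ x)) (a ∸ c) c))
                 (trans (∑-swap-*ˡ b₂ (suc a) (a C_) (λ q c → G (λ x y → W x (q ∷ y)) (a ∸ c) c))
                        (∑-cong (suc a) (λ {c} _ → cong ((a C c) *_)
                          (sym (∑Seq-∑ (a ∸ c) b₁ b₂ (λ q x → ∑Seq c b₂ (λ y → W x (q ∷ y)))))))) ⟩
  ∑ (suc a) (λ c → (a C c) * G W (suc (a ∸ c)) c) + ∑ (suc a) (λ c → (a C c) * G W (a ∸ c) (suc c))
    ≡⟨ ∑-pascal a (G W) ⟩
  ∑ (suc (suc a)) (λ c → (suc a C c) * G W (suc a ∸ c) c)
    ∎
  where
  G : (List ℕ → List ℕ → ℕ) → ℕ → ℕ → ℕ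
  G V i j = ∑Seq i b₁ (λ x → ∑Seq j b₂ (V x))
  low : ∀ {p} → p < b₁ →
        ∑Seq a (b₁ + b₂) (λ l → W (below b₁ (p ∷ l)) (above b₁ (p ∷ l)))
        ≡ ∑ (suc a) (λ c → (a C c) * G (λ x → W (p ∷ x)) (a ∸ c) c)
  low {p} p<b₁ = trans (∑Seq-cong a (b₁ + b₂) (λ l → cong₂ W (below-< l p<b₁) (above-< l p<b₁)))
                       (∑Seq-split a b₁ b₂ (λ x → W (p ∷ x)))
  high : ∀ q →
         ∑Seq a (b₁ + b₂) (λ l → W (below b₁ (b₁ + q ∷ l)) (above b₁ (b₁ + q ∷ l)))
         ≡ ∑ (suc a) (λ c → (a C c) * G (λ x y → W x (q ∷ y)) (a ∸ c) c)
  high q = trans (∑Seq-cong a (b₁ + b₂) (λ l → cong₂ W (below-≥ l b₁≤b₁+q)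
                   (trans (above-≥ l b₁≤b₁+q) (cong (_∷ above b₁ l) (m+n∸m≡n b₁ q)))))
                 (∑Seq-split a b₁ b₂ (λ x y → W x (q ∷ y)))
    where b₁≤b₁+q = m≤m+n b₁ q

-- Counting entries above a threshold

#≥ : ℕ → List ℕ → ℕ
#≥ s []      = 0
#≥ s (x ∷ l) = 𝟙 (s ≤? x) + #≥ s l

module _ {s x : ℕ} (l : List ℕ) where

  #≥-cons-≤ : s ≤ x → #≥ s (x ∷ l) ≡ suc (#≥ s l)
  #≥-cons-≤ s≤x rewrite dec-true (s ≤? x) s≤x = refl

  #≥-cons-> : x < s → #≥ s (x ∷ l) ≡ #≥ s l
  #≥-cons-> x<s rewrite dec-false (s ≤? x) (<⇒≱ x<s) = refl

#≥-≤-cons : ∀ s x l → #≥ s l ≤ #≥ s (x ∷ l)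
#≥-≤-cons s x l = m≤n+m (#≥ s l) (𝟙 (s ≤? x))

#≥-antitone : ∀ {s t} l → s ≤ t → #≥ t l ≤ #≥ s l
#≥-antitone         []      s≤t = z≤n
#≥-antitone {s} {t} (x ∷ l) s≤t with t ≤? x
... | yes t≤x = subst₂ _≤_ (sym (#≥-cons-≤ l t≤x)) (sym (#≥-cons-≤ l (≤-trans s≤t t≤x)))
                       (s≤s (#≥-antitone l s≤t))
... | no  t≰x = subst (_≤ #≥ s (x ∷ l)) (sym (#≥-cons-> l (≰⇒> t≰x)))
                       (≤-trans (#≥-antitone l s≤t) (#≥-≤-cons s x l))

#≥-zero : ∀ l → #≥ 0 l ≡ length l
#≥-zero []      = refl
#≥-zero (x ∷ l) = cong suc (#≥-zero l)

∈⇒#≥-positive : ∀ {x s} l → x ∈ l → s ≤ x → 0 < #≥ s l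
∈⇒#≥-positive (x ∷ l) (here refl) s≤x = subst (0 <_) (sym (#≥-cons-≤ l s≤x)) (s≤s z≤n)
∈⇒#≥-positive (y ∷ l) (there x∈l) s≤x = ≤-trans (∈⇒#≥-positive l x∈l s≤x) (#≥-≤-cons _ y l)

#≥-above : ∀ k t l → #≥ (k + t) l ≡ #≥ t (above k l)
#≥-above k t []      = refl
#≥-above k t (x ∷ l) with k ≤? x
... | yes k≤x = trans (cong₂ _+_ (𝟙-⇔ shift (k + t ≤? x) (t ≤? x ∸ k)) (#≥-above k t l))
                     (cong (#≥ t) (sym (above-≥ l k≤x)))
  where
  shift : (k + t ≤ x) ⇔ (t ≤ x ∸ k)
  shift = mk⇔ (λ le → m+n≤o⇒m≤o∸n t (subst (_≤ x) (+-comm k t) le))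
              (λ le → subst (_≤ x) (+-comm t k) (m≤o∸n⇒m+n≤o t k≤x le))
... | no  k≰x = trans (#≥-cons-> l (≤-trans (≰⇒> k≰x) (m≤m+n k t)))
                     (trans (#≥-above k t l) (cong (#≥ t) (sym (above-< l (≰⇒> k≰x)))))

#≥-below-above : ∀ {s k} l → s ≤ k → #≥ s l ≡ #≥ s (below k l) + length (above k l)
#≥-below-above         []      s≤k = refl
#≥-below-above {s} {k} (x ∷ l) s≤k with k ≤? x
... | yes k≤x rewrite below-≥ l k≤x | above-≥ l k≤x =
  trans (#≥-cons-≤ l (≤-trans s≤k k≤x))
        (trans (cong suc (#≥-below-above l s≤k)) (sym (+-suc _ _)))
... | no  k≰x rewrite below-< l (≰⇒> k≰x) | above-< l (≰⇒> k≰x) =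
  trans (cong (𝟙 (s ≤? x) +_) (#≥-below-above l s≤k)) (sym (+-assoc (𝟙 (s ≤? x)) _ _))

-- Prefixes on which a decidable predicate holds

AllBelow : ∀ {p} → Pred ℕ p → ℕ → Set p
AllBelow P v = ∀ {s} → s < v → P s

FirstFailure : ∀ {p} → Pred ℕ p → ℕ → Set p
FirstFailure P k = ¬ P k × AllBelow P k

module _ {p} {P : Pred ℕ p} (P? : Decidable P) where

  allBelow? : ∀ v → Dec (AllBelow P v)
  allBelow? = allUpTo? P?

  firstFailure? : ∀ k → Dec (FirstFailure P k)
  firstFailure? k = ¬? (P? k) ×-dec allBelow? k

  allBelow-suc : ∀ {v} → AllBelow P (suc v) ⇔ (AllBelow P v × P v)
  allBelow-suc {v} = mk⇔ (λ all → (λ {s} s<v → all (m≤n⇒m≤1+n s<v)) , all ≤-refl) extend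
    where
    extend : AllBelow P v × P v → AllBelow P (suc v)
    extend (all , Pv) {s} (s≤s s≤v) with m≤n⇒m<n∨m≡n s≤v
    ... | inj₁ s<v  = all s<v
    ... | inj₂ refl = Pv

  -- The number of p < N such that P holds on [0, p] is the first failure point of P, or N.
  ∑-allBelow : ∀ N → ∑ N (λ p → 𝟙 (allBelow? (suc p)))
                     ≡ ∑ N (λ k → k * 𝟙 (firstFailure? k)) + N * 𝟙 (allBelow? N)
  ∑-allBelow zero    = refl
  ∑-allBelow (suc N) = begin
    ∑ (suc N) (λ p → 𝟙 (allBelow? (suc p)))
      ≡⟨ ∑-last N _ ⟩
    ∑ N (λ p → 𝟙 (allBelow? (suc p))) + 𝟙 (allBelow? (suc N))
      ≡⟨ cong₂ _+_ (∑-allBelow N) 𝟙-allBelow-suc ⟩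
    (S + N * 𝟙 (allBelow? N)) + 𝟙 (allBelow? N) * 𝟙 (P? N)
      ≡⟨ +-assoc S _ _ ⟩
    S + (N * 𝟙 (allBelow? N) + 𝟙 (allBelow? N) * 𝟙 (P? N))
      ≡⟨ cong (S +_) (step (allBelow? N) (P? N)) ⟩
    S + (N * 𝟙 (firstFailure? N) + suc N * (𝟙 (allBelow? N) * 𝟙 (P? N)))
      ≡⟨ sym (+-assoc S _ _) ⟩
    (S + N * 𝟙 (firstFailure? N)) + suc N * (𝟙 (allBelow? N) * 𝟙 (P? N))
      ≡⟨ cong₂ _+_ (sym (∑-last N (λ k → k * 𝟙 (firstFailure? k))))
                   (cong (suc N *_) (sym 𝟙-allBelow-suc)) ⟩
    ∑ (suc N) (λ k → k * 𝟙 (firstFailure? k)) + suc N * 𝟙 (allBelow? (suc N))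
      ∎
    where
    S = ∑ N (λ k → k * 𝟙 (firstFailure? k))
    𝟙-allBelow-suc : 𝟙 (allBelow? (suc N)) ≡ 𝟙 (allBelow? N) * 𝟙 (P? N)
    𝟙-allBelow-suc = trans (𝟙-⇔ allBelow-suc (allBelow? (suc N)) (allBelow? N ×-dec P? N))
                           (𝟙-× (allBelow? N) (P? N))
    step : ∀ {A B : Set p} (A? : Dec A) (B? : Dec B) →
           N * 𝟙 A? + 𝟙 A? * 𝟙 B? ≡ N * 𝟙 (¬? B? ×-dec A?) + suc N * (𝟙 A? * 𝟙 B?)
    step (yes _) (yes _) = trans (+-comm (N * 1) 1) (cong (_+ suc (N * 1)) (sym (*-zeroʳ N)))
    step (yes _) (no _)  = cong (N * 1 +_) (sym (*-zeroʳ N))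
    step (no _)  (yes _) = cong (N * 0 +_) (sym (*-zeroʳ N))
    step (no _)  (no _)  = cong (N * 0 +_) (sym (*-zeroʳ N))

  ∑-allBelow-failing : ∀ N → ¬ P N → ∑ N (λ p → 𝟙 (allBelow? (suc p)))
                                     ≡ ∑ (suc N) (λ k → k * 𝟙 (firstFailure? k))
  ∑-allBelow-failing N ¬PN = begin
    ∑ N (λ p → 𝟙 (allBelow? (suc p)))
      ≡⟨ ∑-allBelow N ⟩
    ∑ N (λ k → k * 𝟙 (firstFailure? k)) + N * 𝟙 (allBelow? N)
      ≡⟨ cong (λ i → ∑ N (λ k → k * 𝟙 (firstFailure? k)) + N * i)
              (𝟙-⇔ (mk⇔ (¬PN ,_) proj₂) (allBelow? N) (firstFailure? N)) ⟩
    ∑ N (λ k → k * 𝟙 (firstFailure? k)) + N * 𝟙 (firstFailure? N)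
      ≡⟨ sym (∑-last N _) ⟩
    ∑ (suc N) (λ k → k * 𝟙 (firstFailure? k))
      ∎

-- The parking criterion and the first-car recursion

Parking : ℕ → List ℕ → Set
Parking b l = AllBelow (λ s → #≥ s l + s ≤ b) (suc b)

parking? : ∀ b l → Dec (Parking b l)
parking? b l = allBelow? (λ s → #≥ s l + s ≤? b) (suc b)

Slack : ℕ → List ℕ → ℕ → Set
Slack n l s = #≥ s l + s < n

slack? : ∀ n l s → Dec (Slack n l s)
slack? n l s = #≥ s l + s <? n

Parking-cons : ∀ {n p} l → p < n → Parking n (p ∷ l) ⇔ (Parking n l × AllBelow (Slack n l) (suc p))
Parking-cons {n} {p} l p<n = mk⇔ split join
  where
  split : Parking n (p ∷ l) → Parking n l × AllBelow (Slack n l) (suc p)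
  split park = (λ {s} s≤n → ≤-trans (+-monoˡ-≤ s (#≥-≤-cons s p l)) (park s≤n))
             , (λ {s} s<1+p → subst (λ i → i + s ≤ n) (#≥-cons-≤ l (≤-pred s<1+p))
                                    (park (≤-trans s<1+p (s≤s (<⇒≤ p<n)))))
  join : Parking n l × AllBelow (Slack n l) (suc p) → Parking n (p ∷ l)
  join (park , slack) {s} s≤n with s ≤? p
  ... | yes s≤p = subst (λ i → i + s ≤ n) (sym (#≥-cons-≤ l s≤p)) (slack (s≤s s≤p))
  ... | no  s≰p = subst (λ i → i + s ≤ n) (sym (#≥-cons-> l (≰⇒> s≰p))) (park s≤n)

#PF : ℕ → ℕ → ℕ
#PF a b = ∑Seq a b (λ l → 𝟙 (parking? b l))

#PF-firstTight : ℕ → ℕ → ℕ → ℕ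
#PF-firstTight a n k = ∑Seq a n (λ l → 𝟙 (parking? n l ×-dec firstFailure? (slack? n l) k))

#PF-suc : ∀ m n → #PF (suc m) n ≡ ∑ (suc n) (λ k → k * #PF-firstTight m n k)
#PF-suc m n = begin
  ∑ n (λ p → ∑Seq m n (λ l → 𝟙 (parking? n (p ∷ l))))
    ≡⟨ ∑-cong n (λ p<n → ∑Seq-cong m n (λ l → first-car l p<n)) ⟩
  ∑ n (λ p → ∑Seq m n (λ l → below-tight l p))
    ≡⟨ sym (∑Seq-∑ m n n (λ p l → below-tight l p)) ⟩
  ∑Seq m n (λ l → ∑ n (below-tight l))
    ≡⟨ ∑Seq-cong m n by-first-tight ⟩
  ∑Seq m n (λ l → ∑ (suc n) (λ k → k * tight-at l k))
    ≡⟨ ∑Seq-∑ m n (suc n) (λ k l → k * tight-at l k) ⟩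
  ∑ (suc n) (λ k → ∑Seq m n (λ l → k * tight-at l k))
    ≡⟨ ∑-cong (suc n) (λ {k} _ → ∑Seq-*ˡ m n k (λ l → tight-at l k)) ⟩
  ∑ (suc n) (λ k → k * #PF-firstTight m n k)
    ∎
  where
  below-tight tight-at : List ℕ → ℕ → ℕ
  below-tight l p = 𝟙 (parking? n l) * 𝟙 (allBelow? (slack? n l) (suc p))
  tight-at l k = 𝟙 (parking? n l ×-dec firstFailure? (slack? n l) k)
  first-car : ∀ l {p} → p < n → 𝟙 (parking? n (p ∷ l)) ≡ below-tight l p
  first-car l {p} p<n =
    trans (𝟙-⇔ (Parking-cons l p<n) (parking? n (p ∷ l)) (parking? n l ×-dec prefix?))
          (𝟙-× (parking? n l) prefix?)
    where prefix? = allBelow? (slack? n l) (suc p)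
  by-first-tight : ∀ l → ∑ n (below-tight l) ≡ ∑ (suc n) (λ k → k * tight-at l k)
  by-first-tight l = begin
    ∑ n (λ p → x * 𝟙 (allBelow? (slack? n l) (suc p)))
      ≡⟨ ∑-*ˡ n x (λ p → 𝟙 (allBelow? (slack? n l) (suc p))) ⟩
    x * ∑ n (λ p → 𝟙 (allBelow? (slack? n l) (suc p)))
      ≡⟨ cong (x *_) (∑-allBelow-failing (slack? n l) n (m+n≮n (#≥ n l) n)) ⟩
    x * ∑ (suc n) (λ k → k * 𝟙 (firstFailure? (slack? n l) k))
      ≡⟨ sym (∑-*ˡ (suc n) x (λ k → k * 𝟙 (firstFailure? (slack? n l) k))) ⟩
    ∑ (suc n) (λ k → x * (k * 𝟙 (firstFailure? (slack? n l) k)))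
      ≡⟨ ∑-cong (suc n) (λ {k} _ →
           trans (*-left-comm x k _) (cong (k *_) (sym (𝟙-× (parking? n l) (firstFailure? (slack? n l) k))))) ⟩
    ∑ (suc n) (λ k → k * tight-at l k)
      ∎
    where x = 𝟙 (parking? n l)

Parking-firstTight⇔ : ∀ k r l →
  (Parking (suc k + r) l × FirstFailure (Slack (suc k + r) l) (suc k))
  ⇔ (length (above (suc k) l) ≡ r × Parking k (below (suc k) l) × Parking r (above (suc k) l))
Parking-firstTight⇔ k r l = mk⇔ split join
  where
  K = suc k
  n = K + r
  L = below K l
  H = above K l
  h = length H
  low : ∀ {s} → s ≤ K → #≥ s l + s ≡ (#≥ s L + s) + h
  low {s} s≤K = trans (cong (_+ s) (#≥-below-above l s≤K)) (+-right-comm (#≥ s L) h s)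
  high : ∀ t → #≥ (K + t) l + (K + t) ≡ K + (#≥ t H + t)
  high t = trans (cong (_+ (K + t)) (#≥-above K t l)) (+-left-comm (#≥ t H) K t)
  #≥K : #≥ K l ≡ h
  #≥K = trans (cong (λ s → #≥ s l) (sym (+-identityʳ K))) (trans (#≥-above K 0 l) (#≥-zero H))
  split : Parking n l × FirstFailure (Slack n l) K → h ≡ r × Parking k L × Parking r H
  split (park , ¬slack , slack) = h≡r , parkL , parkH
    where
    h≡r : h ≡ r
    h≡r = ≤-antisym
      (+-cancelˡ-≤ K h r (subst (_≤ n) (trans (cong (_+ K) #≥K) (+-comm h K)) (park (s≤s (m≤m+n K r)))))
      (+-cancelˡ-≤ K r h (subst (n ≤_) (trans (cong (_+ K) #≥K) (+-comm h K)) (≮⇒≥ ¬slack)))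
    parkL : Parking k L
    parkL {s} s<K = +-cancelʳ-≤ r _ k
      (≤-pred (subst (_< n) (trans (low (<⇒≤ s<K)) (cong (#≥ s L + s +_) h≡r)) (slack s<K)))
    parkH : Parking r H
    parkH {t} (s≤s t≤r) = +-cancelˡ-≤ K _ r (subst (_≤ n) (high t) (park (s≤s (+-monoʳ-≤ K t≤r))))
  join : h ≡ r × Parking k L × Parking r H → Parking n l × FirstFailure (Slack n l) K
  join (h≡r , parkL , parkH) = park , ¬slack , slack
    where
    low≤ : ∀ {s} → s < K → #≥ s l + s ≤ k + r
    low≤ {s} s<K = subst (_≤ k + r) (sym (trans (low (<⇒≤ s<K)) (cong (#≥ s L + s +_) h≡r)))
                         (+-monoˡ-≤ r (parkL s<K))
    park : Parking n l
    park {s} s<1+n with s <? K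
    ... | yes s<K = m≤n⇒m≤1+n (low≤ s<K)
    ... | no  s≮K = subst (λ i → #≥ i l + i ≤ n) (m+[n∸m]≡n K≤s)
                          (subst (_≤ n) (sym (high t)) (+-monoʳ-≤ K (parkH (s≤s t≤r))))
      where
      K≤s = ≮⇒≥ s≮K
      t = s ∸ K
      t≤r : t ≤ r
      t≤r = subst (t ≤_) (m+n∸m≡n K r) (∸-monoˡ-≤ K (≤-pred s<1+n))
    ¬slack : ¬ Slack n l K
    ¬slack slackK = <-irrefl (+-comm r K)
      (subst (_< n) (cong (_+ K) (trans #≥K h≡r)) slackK)
    slack : AllBelow (Slack n l) K
    slack s<K = s≤s (low≤ s<K)

∈⇒¬Parking : ∀ {b} l → b ∈ l → ¬ Parking b l
∈⇒¬Parking {b} l b∈l park =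
  <-irrefl refl (≤-trans (+-monoˡ-≤ b (∈⇒#≥-positive l b∈l ≤-refl)) (park ≤-refl))

∑Seq-parking-widen : ∀ a b → ∑Seq a (suc b) (λ l → 𝟙 (parking? b l)) ≡ #PF a b
∑Seq-parking-widen a b = ∑Seq-restrict a b (λ l → 𝟙 (parking? b l))
  (λ l b∈l → cong (if_then 1 else 0) (dec-false (parking? b l) (∈⇒¬Parking l b∈l)))

#PF-firstTight-split : ∀ m k r →
  #PF-firstTight m (suc k + r) (suc k) ≡ (m C r) * (#PF (m ∸ r) k * #PF r r)
#PF-firstTight-split m k r = begin
  #PF-firstTight m n K
    ≡⟨ ∑Seq-cong m n (λ l → 𝟙-split l) ⟩
  ∑Seq m (K + r) (λ l → W (below K l) (above K l))
    ≡⟨ ∑Seq-split m K r W ⟩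
  ∑ (suc m) (λ c → (m C c) * ∑Seq (m ∸ c) K (λ x → ∑Seq c r (W x)))
    ≡⟨ ∑-cong (suc m) (λ {c} _ → cong ((m C c) *_) (count c)) ⟩
  ∑ (suc m) (λ c → (m C c) * (𝟙 (c ≟ r) * X c))
    ≡⟨ ∑-cong (suc m) (λ {c} _ → *-left-comm (m C c) (𝟙 (c ≟ r)) (X c)) ⟩
  ∑ (suc m) (λ c → 𝟙 (c ≟ r) * ((m C c) * X c))
    ≡⟨ ∑-select (suc m) r (λ c → (m C c) * X c) (λ {c} m<c → cong (_* X c) (k>n⇒nCk≡0 m<c)) ⟩
  (m C r) * X r
    ∎
  where
  K = suc k
  n = K + r
  X : ℕ → ℕ
  X c = #PF (m ∸ c) k * #PF c r
  W : List ℕ → List ℕ → ℕ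
  W x y = 𝟙 (length y ≟ r) * (𝟙 (parking? k x) * 𝟙 (parking? r y))
  𝟙-split : ∀ l → 𝟙 (parking? n l ×-dec firstFailure? (slack? n l) K) ≡ W (below K l) (above K l)
  𝟙-split l = begin
    𝟙 (parking? n l ×-dec firstFailure? (slack? n l) K)
      ≡⟨ 𝟙-⇔ (Parking-firstTight⇔ k r l) (parking? n l ×-dec firstFailure? (slack? n l) K)
             (size? ×-dec lower? ×-dec upper?) ⟩
    𝟙 (size? ×-dec lower? ×-dec upper?)
      ≡⟨ 𝟙-× size? (lower? ×-dec upper?) ⟩
    𝟙 size? * 𝟙 (lower? ×-dec upper?)
      ≡⟨ cong (𝟙 size? *_) (𝟙-× lower? upper?) ⟩
    W (below K l) (above K l)
      ∎
    where
    size? = length (above K l) ≟ r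
    lower? = parking? k (below K l)
    upper? = parking? r (above K l)
  count : ∀ c → ∑Seq (m ∸ c) K (λ x → ∑Seq c r (W x)) ≡ 𝟙 (c ≟ r) * X c
  count c = begin
    ∑Seq (m ∸ c) K (λ x → ∑Seq c r (W x))
      ≡⟨ ∑Seq-cong (m ∸ c) K inner ⟩
    ∑Seq (m ∸ c) K (λ x → 𝟙 (c ≟ r) * (𝟙 (parking? k x) * #PF c r))
      ≡⟨ ∑Seq-*ˡ (m ∸ c) K (𝟙 (c ≟ r)) (λ x → 𝟙 (parking? k x) * #PF c r) ⟩
    𝟙 (c ≟ r) * ∑Seq (m ∸ c) K (λ x → 𝟙 (parking? k x) * #PF c r)
      ≡⟨ cong (𝟙 (c ≟ r) *_) (∑Seq-*ʳ (m ∸ c) K (#PF c r) (λ x → 𝟙 (parking? k x))) ⟩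
    𝟙 (c ≟ r) * (∑Seq (m ∸ c) K (λ x → 𝟙 (parking? k x)) * #PF c r)
      ≡⟨ cong (λ i → 𝟙 (c ≟ r) * (i * #PF c r)) (∑Seq-parking-widen (m ∸ c) k) ⟩
    𝟙 (c ≟ r) * X c
      ∎
    where
    inner : ∀ x → ∑Seq c r (W x) ≡ 𝟙 (c ≟ r) * (𝟙 (parking? k x) * #PF c r)
    inner x = begin
      ∑Seq c r (λ y → 𝟙 (length y ≟ r) * (𝟙 (parking? k x) * 𝟙 (parking? r y)))
        ≡⟨ ∑Seq-length c r (λ j y → 𝟙 (j ≟ r) * (𝟙 (parking? k x) * 𝟙 (parking? r y))) ⟩
      ∑Seq c r (λ y → 𝟙 (c ≟ r) * (𝟙 (parking? k x) * 𝟙 (parking? r y)))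
        ≡⟨ ∑Seq-*ˡ c r (𝟙 (c ≟ r)) (λ y → 𝟙 (parking? k x) * 𝟙 (parking? r y)) ⟩
      𝟙 (c ≟ r) * ∑Seq c r (λ y → 𝟙 (parking? k x) * 𝟙 (parking? r y))
        ≡⟨ cong (𝟙 (c ≟ r) *_) (∑Seq-*ˡ c r (𝟙 (parking? k x)) (λ y → 𝟙 (parking? r y))) ⟩
      𝟙 (c ≟ r) * (𝟙 (parking? k x) * #PF c r)
        ∎

-- The parking process

vacant : ∀ {b} → ℕ → Vec Bool b → ℕ
vacant s       []           = 0
vacant zero    (false ∷ st) = suc (vacant zero st)
vacant zero    (true ∷ st)  = vacant zero st
vacant (suc s) (_ ∷ st)     = vacant s st

vacant-emptySpots : ∀ b s → vacant s (emptySpots b) ≡ b ∸ s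
vacant-emptySpots zero    zero    = refl
vacant-emptySpots zero    (suc s) = refl
vacant-emptySpots (suc b) zero    = cong suc (vacant-emptySpots b zero)
vacant-emptySpots (suc b) (suc s) = vacant-emptySpots b s

parkFrom-nothing : ∀ {b} p (st : Vec Bool b) → parkFrom p st ≡ nothing → vacant p st ≡ 0
parkFrom-nothing p       []           e = refl
parkFrom-nothing zero    (true ∷ st)  e with parkFrom zero st in eq
... | nothing = parkFrom-nothing zero st eq
parkFrom-nothing (suc p) (x ∷ st)     e with parkFrom p st in eq
... | nothing = parkFrom-nothing p st eq

-- The car preferring p parks at q, the first vacant spot ≥ p, turning st into st′.
record ParksAt {b} (p q : ℕ) (st st′ : Vec Bool b) : Set where
  field
    p≤q    : p ≤ q
    before : ∀ {s} → s ≤ q → vacant s st ≡ suc (vacant s st′)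
    after  : ∀ {s} → q < s → vacant s st ≡ vacant s st′
    gap    : ∀ {s} → p ≤ s → s ≤ q → vacant s st ≡ vacant p st

parksAt-here : ∀ {b} (st : Vec Bool b) → ParksAt 0 0 (false ∷ st) (true ∷ st)
parksAt-here st = record
  { p≤q = z≤n ; before = λ { z≤n → refl } ; after = λ { {suc s} _ → refl } ; gap = λ { z≤n z≤n → refl } }

parksAt-skip : ∀ {b q} {st st′ : Vec Bool b} →
               ParksAt 0 q st st′ → ParksAt 0 (suc q) (true ∷ st) (true ∷ st′)
parksAt-skip {q = q} {st} {st′} P = record { p≤q = z≤n ; before = before′ ; after = after′ ; gap = gap′ }
  where
  open ParksAt P
  before′ : ∀ {s} → s ≤ suc q → vacant s (true ∷ st) ≡ suc (vacant s (true ∷ st′))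
  before′ {zero}  _         = before z≤n
  before′ {suc s} (s≤s s≤q) = before s≤q
  after′ : ∀ {s} → suc q < s → vacant s (true ∷ st) ≡ vacant s (true ∷ st′)
  after′ {suc s} (s≤s q<s) = after q<s
  gap′ : ∀ {s} → 0 ≤ s → s ≤ suc q → vacant s (true ∷ st) ≡ vacant 0 (true ∷ st)
  gap′ {zero}  _ _         = refl
  gap′ {suc s} _ (s≤s s≤q) = gap z≤n s≤q

parksAt-later : ∀ {b p q} x {st st′ : Vec Bool b} →
                ParksAt p q st st′ → ParksAt (suc p) (suc q) (x ∷ st) (x ∷ st′)
parksAt-later {p = p} {q} x {st} {st′} P =
  record { p≤q = s≤s p≤q ; before = before′ ; after = after′ ; gap = gap′ }
  where
  open ParksAt P
  before′ : ∀ {s} → s ≤ suc q → vacant s (x ∷ st) ≡ suc (vacant s (x ∷ st′))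
  before′ {zero} _ = front x
    where
    front : ∀ y → vacant 0 (y ∷ st) ≡ suc (vacant 0 (y ∷ st′))
    front false = cong suc (before z≤n)
    front true  = before z≤n
  before′ {suc s} (s≤s s≤q) = before s≤q
  after′ : ∀ {s} → suc q < s → vacant s (x ∷ st) ≡ vacant s (x ∷ st′)
  after′ {suc s} (s≤s q<s) = after q<s
  gap′ : ∀ {s} → suc p ≤ s → s ≤ suc q → vacant s (x ∷ st) ≡ vacant (suc p) (x ∷ st)
  gap′ {suc s} (s≤s p≤s) (s≤s s≤q) = gap p≤s s≤q

parkFrom-just : ∀ {b} p (st st′ : Vec Bool b) → parkFrom p st ≡ just st′ → ∃[ q ] ParksAt p q st st′
parkFrom-just zero    (false ∷ st) _ refl = 0 , parksAt-here st
parkFrom-just zero    (true ∷ st)  _ e with parkFrom zero st in eq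
parkFrom-just zero    (true ∷ st)  _ refl | just st′ =
  let q , P = parkFrom-just zero st st′ eq in suc q , parksAt-skip P
parkFrom-just (suc p) (x ∷ st)     _ e with parkFrom p st in eq
parkFrom-just (suc p) (x ∷ st)     _ refl | just st′ =
  let q , P = parkFrom-just p st st′ eq in suc q , parksAt-later x P

Fits : ∀ {b} → List ℕ → Vec Bool b → Set
Fits l st = ∀ s → #≥ s l ≤ vacant s st

module _ {b p q} {st st′ : Vec Bool b} (P : ParksAt p q st st′) where
  open ParksAt P

  fits-cons : ∀ {l} → Fits l st′ → Fits (p ∷ l) st
  fits-cons {l} fits s with s ≤? p
  ... | yes s≤p = subst₂ _≤_ (sym (#≥-cons-≤ l s≤p)) (sym (before (≤-trans s≤p p≤q))) (s≤s (fits s))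
  ... | no  s≰p = subst (_≤ vacant s st) (sym (#≥-cons-> l (≰⇒> s≰p))) (≤-trans (fits s) shrinks)
    where
    shrinks : vacant s st′ ≤ vacant s st
    shrinks with s ≤? q
    ... | yes s≤q = subst (vacant s st′ ≤_) (sym (before s≤q)) (n≤1+n _)
    ... | no  s≰q = ≤-reflexive (sym (after (≰⇒> s≰q)))

  fits-uncons : ∀ {l} → Fits (p ∷ l) st → Fits l st′
  fits-uncons {l} fits s with s ≤? p
  ... | yes s≤p = ≤-pred (subst₂ _≤_ (#≥-cons-≤ l s≤p) (before (≤-trans s≤p p≤q)) (fits s))
  ... | no  s≰p with s ≤? q
  ...   | no  s≰q = subst₂ _≤_ (#≥-cons-> l (≰⇒> s≰p)) (after (≰⇒> s≰q)) (fits s)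
  ...   | yes s≤q =
    ≤-trans (#≥-antitone l p≤s) (≤-pred (subst₂ _≤_ (#≥-cons-≤ l ≤-refl) vacant-p (fits p)))
    where
    p≤s = <⇒≤ (≰⇒> s≰p)
    vacant-p : vacant p st ≡ suc (vacant s st′)
    vacant-p = trans (sym (gap p≤s s≤q)) (before s≤q)

values : ∀ {a b} → Vec (Fin b) a → List ℕ
values π = Vec.toList (Vec.map toℕ π)

runCars-just⇒Fits : ∀ {a b} (π : Vec (Fin b) a) st {st″} → runCars π st ≡ just st″ → Fits (values π) st
runCars-just⇒Fits []      st e s = z≤n
runCars-just⇒Fits (p ∷ π) st e with parkFrom (toℕ p) st in eq
... | just st′ =
  fits-cons (proj₂ (parkFrom-just (toℕ p) st st′ eq)) {values π} (runCars-just⇒Fits π st′ e)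

Fits⇒runCars-just : ∀ {a b} (π : Vec (Fin b) a) st → Fits (values π) st → runCars π st ≢ nothing
Fits⇒runCars-just (p ∷ π) st fits e with parkFrom (toℕ p) st in eq
... | nothing  =
  contradiction (subst₂ _≤_ (#≥-cons-≤ (values π) ≤-refl) (parkFrom-nothing (toℕ p) st eq) (fits (toℕ p))) λ ()
... | just st′ =
  Fits⇒runCars-just π st′ (fits-uncons (proj₂ (parkFrom-just (toℕ p) st st′ eq)) {values π} fits) e

#≥-values : ∀ {a b s} (π : Vec (Fin b) a) → b ≤ s → #≥ s (values π) ≡ 0
#≥-values []      b≤s = refl
#≥-values (p ∷ π) b≤s = trans (#≥-cons-> (values π) (≤-trans (toℕ<n p) b≤s)) (#≥-values π b≤s)

Parking⇔Fits : ∀ {a b} (π : Vec (Fin b) a) → Parking b (values π) ⇔ Fits (values π) (emptySpots b)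
Parking⇔Fits {b = b} π = mk⇔ to from
  where
  to : Parking b (values π) → Fits (values π) (emptySpots b)
  to park s with s ≤? b
  ... | yes s≤b = subst (#≥ s (values π) ≤_) (sym (vacant-emptySpots b s))
                        (m+n≤o⇒m≤o∸n (#≥ s (values π)) (park (s≤s s≤b)))
  ... | no  s≰b = subst (_≤ vacant s (emptySpots b)) (sym (#≥-values π (<⇒≤ (≰⇒> s≰b)))) z≤n
  from : Fits (values π) (emptySpots b) → Parking b (values π)
  from fits {s} (s≤s s≤b) =
    m≤o∸n⇒m+n≤o (#≥ s (values π)) s≤b (subst (#≥ s (values π) ≤_) (vacant-emptySpots b s) (fits s))

isParking≡parking? : ∀ {a b} (π : Vec (Fin b) a) → isParking π ≡ does (parking? b (values π))
isParking≡parking? {b = b} π with runCars π (emptySpots b) in eq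
... | just _  =
  sym (dec-true (parking? b (values π)) (Equivalence.from (Parking⇔Fits π) (runCars-just⇒Fits π _ eq)))
... | nothing =
  sym (dec-false (parking? b (values π)) (λ park → Fits⇒runCars-just π _ (Equivalence.to (Parking⇔Fits π) park) eq))

length-filter-true : ∀ {A : Set} (f : A → Bool) xs →
  length (filter (λ x → f x ≟ᵇ true) xs) ≡ sum (map (λ x → if f x then 1 else 0) xs)
length-filter-true f []       = refl
length-filter-true f (x ∷ xs) with f x
... | true  = cong suc (length-filter-true f xs)
... | false = length-filter-true f xs

sum-map-concatMap : ∀ {A B : Set} (g : B → ℕ) (h : A → List B) xs →
  sum (map g (concatMap h xs)) ≡ sum (map (λ x → sum (map g (h x))) xs)
sum-map-concatMap g h []       = refl
sum-map-concatMap g h (x ∷ xs) = begin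
  sum (map g (h x ++ concatMap h xs))
    ≡⟨ cong sum (map-++ g (h x) (concatMap h xs)) ⟩
  sum (map g (h x) ++ map g (concatMap h xs))
    ≡⟨ sum-++ (map g (h x)) _ ⟩
  sum (map g (h x)) + sum (map g (concatMap h xs))
    ≡⟨ cong (sum (map g (h x)) +_) (sum-map-concatMap g h xs) ⟩
  sum (map (λ x → sum (map g (h x))) (x ∷ xs))
    ∎

sum-map-allFinL : ∀ b (f : ℕ → ℕ) → sum (map (λ p → f (toℕ p)) (allFinL b)) ≡ ∑ b f
sum-map-allFinL zero    f = refl
sum-map-allFinL (suc b) f = cong (f 0 +_) (trans (cong sum (sym (map-∘ (allFinL b))))
                                                 (sum-map-allFinL b (λ i → f (suc i))))

sum-map-allSeqs : ∀ a b (w : List ℕ → ℕ) → sum (map (λ π → w (values π)) (allSeqs a b)) ≡ ∑Seq a b w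
sum-map-allSeqs zero    b w = +-identityʳ (w [])
sum-map-allSeqs (suc a) b w = begin
  sum (map (λ π → w (values π)) (concatMap (λ p → map (p ∷_) (allSeqs a b)) (allFinL b)))
    ≡⟨ sum-map-concatMap (λ π → w (values π)) (λ p → map (p ∷_) (allSeqs a b)) (allFinL b) ⟩
  sum (map (λ p → sum (map (λ π → w (values π)) (map (p ∷_) (allSeqs a b)))) (allFinL b))
    ≡⟨ cong sum (map-cong (λ p → trans (cong sum (sym (map-∘ (allSeqs a b))))
                                       (sum-map-allSeqs a b (λ l → w (toℕ p ∷ l)))) (allFinL b)) ⟩
  sum (map (λ p → ∑Seq a b (λ l → w (toℕ p ∷ l))) (allFinL b))
    ≡⟨ sum-map-allFinL b (λ i → ∑Seq a b (λ l → w (i ∷ l))) ⟩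
  ∑Seq (suc a) b w
    ∎

countPF≡#PF : ∀ a b → countPF a b ≡ #PF a b
countPF≡#PF a b = begin
  length (filter (λ π → isParking π ≟ᵇ true) (allSeqs a b))
    ≡⟨ length-filter-true isParking (allSeqs a b) ⟩
  sum (map (λ π → if isParking π then 1 else 0) (allSeqs a b))
    ≡⟨ cong sum (map-cong (λ π → cong (if_then 1 else 0) (isParking≡parking? π)) (allSeqs a b)) ⟩
  sum (map (λ π → 𝟙 (parking? b (values π))) (allSeqs a b))
    ≡⟨ sum-map-allSeqs a b (λ l → 𝟙 (parking? b l)) ⟩
  #PF a b
    ∎

sumFromTo-empty : ∀ lo hi (f : ℕ → ℕ) → hi < lo → sumFromTo lo hi f ≡ 0
sumFromTo-empty lo hi f hi<lo rewrite m≤n⇒m∸n≡0 hi<lo = refl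

sumFromTo-suc : ∀ lo hi (f : ℕ → ℕ) → lo ≤ suc hi →
                sumFromTo lo (suc hi) f ≡ f (lo + (suc hi ∸ lo)) + sumFromTo lo hi f
sumFromTo-suc lo hi f lo≤1+hi rewrite +-∸-assoc 1 lo≤1+hi = refl

∑≡sumFromTo : ∀ lo hi (f : ℕ → ℕ) → (∀ {k} → k < lo → f k ≡ 0) →
              ∑ (suc hi) f ≡ sumFromTo lo hi f
∑≡sumFromTo zero    zero     f _   = refl
∑≡sumFromTo (suc lo) zero    f f≡0 = trans (cong (_+ 0) (f≡0 (s≤s z≤n)))
                                           (sym (sumFromTo-empty (suc lo) 0 f (s≤s z≤n)))
∑≡sumFromTo lo      (suc hi) f f≡0 with lo ≤? suc hi
... | yes lo≤1+hi = begin
  ∑ (suc (suc hi)) f                             ≡⟨ ∑-last (suc hi) f ⟩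
  ∑ (suc hi) f + f (suc hi)                      ≡⟨ cong₂ _+_ (∑≡sumFromTo lo hi f f≡0)
                                                              (cong f (sym (m+[n∸m]≡n lo≤1+hi))) ⟩
  sumFromTo lo hi f + f (lo + (suc hi ∸ lo))     ≡⟨ +-comm (sumFromTo lo hi f) _ ⟩
  f (lo + (suc hi ∸ lo)) + sumFromTo lo hi f     ≡⟨ sym (sumFromTo-suc lo hi f lo≤1+hi) ⟩
  sumFromTo lo (suc hi) f                        ∎
... | no  lo≰1+hi = trans (∑-zero (suc (suc hi)) (λ k<2+hi → f≡0 (≤-trans k<2+hi hi<lo)))
                          (sym (sumFromTo-empty lo (suc hi) f hi<lo))
  where hi<lo = ≰⇒> lo≰1+hi

#PF-firstTight-at : ∀ m {n k} → k < n →
  #PF-firstTight m n (suc k) ≡ (m C (n ∸ suc k)) * (#PF (m ∸ (n ∸ suc k)) k * #PF (n ∸ suc k) (n ∸ suc k))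
#PF-firstTight-at m {n} {k} k<n = trans (cong (λ i → #PF-firstTight m i (suc k)) (sym (m+[n∸m]≡n k<n)))
                                         (#PF-firstTight-split m k (n ∸ suc k))

summand : ℕ → ℕ → ℕ → ℕ
summand m n k = k * ((m ∸ 1) C (n ∸ k)) * countPF ((m + k) ∸ suc n) (k ∸ 1) * countPF (n ∸ k) (n ∸ k)

summand-vanishes : ∀ m n k → k + suc m ≤ n → summand (suc m) n k ≡ 0
summand-vanishes m n k k+m<n =
  trans (cong (λ c → k * c * X * Y) (k>n⇒nCk≡0 m<n∸k)) (cong (λ z → z * X * Y) (*-zeroʳ k))
  where
  m<n∸k = m+n≤o⇒m≤o∸n (suc m) (subst (_≤ n) (+-comm k (suc m)) k+m<n)
  X = countPF ((suc m + k) ∸ suc n) (k ∸ 1)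
  Y = countPF (n ∸ k) (n ∸ k)

k*#PF-firstTight≡summand : ∀ m n k → k ≤ n → k * #PF-firstTight m n k ≡ summand (suc m) n k
k*#PF-firstTight≡summand m n zero    _   = refl
k*#PF-firstTight≡summand m n (suc k) k<n = begin
  suc k * #PF-firstTight m n (suc k)
    ≡⟨ cong (suc k *_) (#PF-firstTight-at m k<n) ⟩
  suc k * ((m C r) * (#PF (m ∸ r) k * #PF r r))
    ≡⟨ sym (trans (*-assoc (suc k * (m C r)) _ _) (*-assoc (suc k) (m C r) _)) ⟩
  suc k * (m C r) * #PF (m ∸ r) k * #PF r r
    ≡⟨ cong₂ (λ a b → suc k * (m C r) * a * b)
             (sym (trans (countPF≡#PF (m + suc k ∸ n) k) (cong (λ i → #PF i k) index)))
             (sym (countPF≡#PF r r)) ⟩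
  summand (suc m) n (suc k)
    ∎
  where
  r = n ∸ suc k
  index : m + suc k ∸ n ≡ m ∸ r
  index = trans (cong₂ _∸_ (+-comm m (suc k)) (sym (m+[n∸m]≡n k<n))) ([m+n]∸[m+o]≡n∸o (suc k) m r)

corollary3p5 : (m n : ℕ) → 1 ≤ m → m ≤ n →
    countPF m n ≡
      sumFromTo (suc (n ∸ m)) n
        (λ k → k * ((m ∸ 1) C (n ∸ k)) * countPF ((m + k) ∸ suc n) (k ∸ 1) * countPF (n ∸ k) (n ∸ k))
corollary3p5 (suc m) n _ m<n = begin
  countPF (suc m) n
    ≡⟨ countPF≡#PF (suc m) n ⟩
  #PF (suc m) n
    ≡⟨ #PF-suc m n ⟩
  ∑ (suc n) (λ k → k * #PF-firstTight m n k)
    ≡⟨ ∑-cong (suc n) (λ k<1+n → k*#PF-firstTight≡summand m n _ (≤-pred k<1+n)) ⟩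
  ∑ (suc n) (summand (suc m) n)
    ≡⟨ ∑≡sumFromTo (suc (n ∸ suc m)) n (summand (suc m) n) low-vanishes ⟩
  sumFromTo (suc (n ∸ suc m)) n (summand (suc m) n)
    ∎
  where
  low-vanishes : ∀ {k} → k < suc (n ∸ suc m) → summand (suc m) n k ≡ 0
  low-vanishes {k} (s≤s k≤n-m) = summand-vanishes m n k (m≤o∸n⇒m+n≤o k m<n k≤n-m)
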